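{- Let $m>1$ be an integer. The maps $\mathcal{F}^{\leq\frac{1}{2}}(\mathbb{B}(2m),m)\to\mathcal{F}_m$, $\frac{h}{k}\mapsto\frac{h}{k-h}$, and $\mathcal{F}_m\to\mathcal{F}^{\leq\frac{1}{2}}(\mathbb{B}(2m),m)$, $\frac{h}{k}\mapsto\frac{h}{k+h}$, are well defined, order-preserving and bijective. The maps $\mathcal{F}^{\geq\frac{1}{2}}(\mathbb{B}(2m),m)\to\mathcal{F}_m$, $\frac{h}{k}\mapsto\frac{k-h}{h}$, and $\mathcal{F}_m\to\mathcal{F}^{\geq\frac{1}{2}}(\mathbb{B}(2m),m)$, $\frac{h}{k}\mapsto\frac{k}{k+h}$, are well defined, order-reversing and bijective.
   Context: For a positive integer $n$, $\mathcal{F}_n$ is the Farey sequence of order $n$: the ascending sequence of irreducible fractions $\frac hk$ with integers $0\le h\le k\le n$, $k\ge1$. For a positive integer $m$, $\mathcal{F}(\mathbb{B}(2m),m)$ is the ascending sequence $\left(\frac{h}{k}\in\mathcal{F}_{2m}:\ h\le m,\ k-h\le m\right)$, with halfsequences $\mathcal{F}^{\leq\frac12}(\mathbb{B}(2m),m)=\left(f\in\mathcal{F}(\mathbb{B}(2m),m): f\le\frac12\right)$ and $\mathcal{F}^{\geq\frac12}(\mathbb{B}(2m),m)=\left(f\in\mathcal{F}(\mathbb{B}(2m),m): f\ge\frac12\right)$. Fractions $\frac hk$ are written in lowest terms. -}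

module Defs where

open import Data.Nat using (ℕ; _+_; _*_; _∸_; _≤_; _<_)
open import Data.Nat.Coprimality using (Coprime)
open import Data.Product using (_×_; _,_; Σ; proj₁; proj₂)
open import Relation.Binary.PropositionalEquality using (_≡_)

-- A fraction h/k is represented by the pair (h , k); membership predicates
-- below require it to be in lowest terms (Coprime h k).
Frac : Set
Frac = ℕ × ℕ

num : Frac → ℕ
num = proj₁

den : Frac → ℕ
den = proj₂

InFarey : ℕ → Frac → Set
InFarey n (h , k) = Coprime h k × h ≤ k × k ≤ n × 1 ≤ k

InFB : ℕ → Frac → Set
InFB m (h , k) = InFarey (2 * m) (h , k) × h ≤ m × k ∸ h ≤ m

InFB≤½ : ℕ → Frac → Set
InFB≤½ m (h , k) = InFB m (h , k) × 2 * h ≤ k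

InFB≥½ : ℕ → Frac → Set
InFB≥½ m (h , k) = InFB m (h , k) × k ≤ 2 * h

-- strict order of fractions with positive denominators: h/k < h'/k'
_<F_ : Frac → Frac → Set
(h , k) <F (h' , k') = h * k' < h' * k

toFarey≤ : Frac → Frac
toFarey≤ (h , k) = (h , k ∸ h)

fromFarey≤ : Frac → Frac
fromFarey≤ (h , k) = (h , k + h)

toFarey≥ : Frac → Frac
toFarey≥ (h , k) = (k ∸ h , h)

fromFarey≥ : Frac → Frac
fromFarey≥ (h , k) = (k , k + h)

WellDefined : (Frac → Set) → (Frac → Set) → (Frac → Frac) → Set
WellDefined P Q f = ∀ x → P x → Q (f x)

OrderPreserving : (Frac → Set) → (Frac → Frac) → Set
OrderPreserving P f = ∀ x y → P x → P y → x <F y → f x <F f y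

OrderReversing : (Frac → Set) → (Frac → Frac) → Set
OrderReversing P f = ∀ x y → P x → P y → x <F y → f y <F f x

BijectiveOn : (Frac → Set) → (Frac → Set) → (Frac → Frac) → Set
BijectiveOn P Q f =
  (∀ x y → P x → P y → f x ≡ f y → x ≡ y) ×
  (∀ y → Q y → Σ Frac (λ x → P x × f x ≡ y))

GoodIncreasing : (Frac → Set) → (Frac → Set) → (Frac → Frac) → Set
GoodIncreasing P Q f = WellDefined P Q f × OrderPreserving P f × BijectiveOn P Q f

GoodDecreasing : (Frac → Set) → (Frac → Set) → (Frac → Frac) → Set
GoodDecreasing P Q f = WellDefined P Q f × OrderReversing P f × BijectiveOn P Q f

-- Since gcd(h, k) = gcd(h, k - h), the map h/k ↦ h/(k - h) sends irreducible fractions to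
-- irreducible fractions, and for h/k ≤ 1/2 the conditions h ≤ m, k - h ≤ m defining 𝔹(2m)
-- become exactly h ≤ k - h ≤ m, i.e. h/(k - h) ∈ 𝓕_m; h/(k + h) is its inverse. As a
-- function of x = h/k it is x ↦ x/(1 - x), which is increasing. For h/k ≥ 1/2 the map
-- h/k ↦ (k - h)/h is the reciprocal of the previous one, hence decreasing, and the
-- conditions become k - h ≤ h ≤ m.
module Submission where

open import Defs
open import Data.Nat using (ℕ; _<_; _≤_; _+_; _*_; _∸_; zero; suc; z<s)
open import Data.Nat.Properties
open import Data.Nat.Divisibility using (∣m∸n∣n⇒∣m)
open import Data.Nat.Coprimality using (Coprime; coprime-+)
import Data.Nat.Coprimality as Coprime
open import Data.Product using (_×_; _,_; proj₁; swap)
open import Function using (flip)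
open import Relation.Nullary using (contradiction)
open import Relation.Binary.PropositionalEquality

private
  variable
    m n : ℕ

2*n≡n+n : ∀ n → 2 * n ≡ n + n
2*n≡n+n n = cong (n +_) (+-identityʳ n)

+-≤-2* : ∀ {a b} → a ≤ n → b ≤ n → a + b ≤ 2 * n
+-≤-2* {n} a≤n b≤n = ≤-trans (+-mono-≤ a≤n b≤n) (≤-reflexive (sym (2*n≡n+n n)))

2*m≤n⇒m≤n∸m : ∀ m → 2 * m ≤ n → m ≤ n ∸ m
2*m≤n⇒m≤n∸m m 2m≤n = m+n≤o⇒m≤o∸n m (≤-trans (≤-reflexive (sym (2*n≡n+n m))) 2m≤n)

2*m≤n⇒0<n∸m : ∀ m → 0 < n → 2 * m ≤ n → 0 < n ∸ m
2*m≤n⇒0<n∸m zero    0<n _    = 0<n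
2*m≤n⇒0<n∸m (suc m) _   2m≤n = <-≤-trans z<s (2*m≤n⇒m≤n∸m (suc m) 2m≤n)

m≤2*n⇒m∸n≤n : m ≤ 2 * n → m ∸ n ≤ n
m≤2*n⇒m∸n≤n {m} {n} m≤2n = m≤n+o⇒m∸n≤o m n (≤-trans m≤2n (≤-reflexive (2*n≡n+n n)))

m≤2*n⇒0<n : 0 < m → m ≤ 2 * n → 0 < n
m≤2*n⇒0<n {n = zero}  0<m m≤0 = contradiction (<-≤-trans 0<m m≤0) n≮0
m≤2*n⇒0<n {n = suc n} _   _   = z<s

coprime-+ʳ : Coprime m n → Coprime m (n + m)
coprime-+ʳ {m} {n} c = Coprime.sym (subst (flip Coprime m) (+-comm m n) (coprime-+ (Coprime.sym c)))

coprime-∸ : m ≤ n → Coprime m n → Coprime m (n ∸ m)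
coprime-∸ m≤n c (d∣m , d∣n∸m) = c (d∣m , ∣m∸n∣n⇒∣m _ m≤n d∣n∸m d∣m)

swap-<F : ∀ x y → x <F y → swap y <F swap x
swap-<F (h , k) (h' , k') lt = subst₂ _<_ (*-comm h k') (*-comm h' k) lt

toFarey≤-mono : ∀ x y → num y ≤ den y → x <F y → toFarey≤ x <F toFarey≤ y
toFarey≤-mono (h , k) (h' , k') h'≤k' lt = begin-strict
  h * (k' ∸ h')    ≡⟨ *-distribˡ-∸ h k' h' ⟩
  h * k' ∸ h * h'  <⟨ ∸-monoˡ-< lt (*-monoʳ-≤ h h'≤k') ⟩
  h' * k ∸ h * h'  ≡⟨ cong (h' * k ∸_) (*-comm h h') ⟩
  h' * k ∸ h' * h  ≡⟨ *-distribˡ-∸ h' k h ⟨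
  h' * (k ∸ h)     ∎
  where open ≤-Reasoning

fromFarey≤-mono : ∀ x y → x <F y → fromFarey≤ x <F fromFarey≤ y
fromFarey≤-mono (h , k) (h' , k') lt = begin-strict
  h * (k' + h')    ≡⟨ *-distribˡ-+ h k' h' ⟩
  h * k' + h * h'  <⟨ +-monoˡ-< (h * h') lt ⟩
  h' * k + h * h'  ≡⟨ cong (h' * k +_) (*-comm h h') ⟩
  h' * k + h' * h  ≡⟨ *-distribˡ-+ h' k h ⟨
  h' * (k + h)     ∎
  where open ≤-Reasoning

toFarey≥-antitone : ∀ x y → num y ≤ den y → x <F y → toFarey≥ y <F toFarey≥ x
toFarey≥-antitone x y h'≤k' lt =
  swap-<F (toFarey≤ x) (toFarey≤ y) (toFarey≤-mono x y h'≤k' lt)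

fromFarey≥-antitone : ∀ x y → x <F y → fromFarey≥ y <F fromFarey≥ x
fromFarey≥-antitone (h , k) (h' , k') lt =
  subst₂ _<_ (cong (k' *_) (+-comm h k)) (cong (k *_) (+-comm h' k'))
    (fromFarey≤-mono (k' , h') (k , h) (swap-<F (h , k) (h' , k') lt))

InFB⇒num≤den : ∀ x → InFB m x → num x ≤ den x
InFB⇒num≤den (h , k) ((_ , h≤k , _) , _) = h≤k

toFarey≤-wellDefined : ∀ m → WellDefined (InFB≤½ m) (InFarey m) toFarey≤
toFarey≤-wellDefined m (h , k) (((c , h≤k , _ , 0<k) , _ , k∸h≤m) , 2h≤k) =
  coprime-∸ h≤k c , 2*m≤n⇒m≤n∸m h 2h≤k , k∸h≤m , 2*m≤n⇒0<n∸m h 0<k 2h≤k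

fromFarey≤-wellDefined : ∀ m → WellDefined (InFarey m) (InFB≤½ m) fromFarey≤
fromFarey≤-wellDefined m (h , k) (c , h≤k , k≤m , 0<k) =
  ( ( coprime-+ʳ c , m≤n+m h k , +-≤-2* k≤m h≤m , ≤-trans 0<k (m≤m+n k h))
  , h≤m , ≤-trans (≤-reflexive (m+n∸n≡m k h)) k≤m)
  , ≤-trans (≤-reflexive (2*n≡n+n h)) (+-monoˡ-≤ h h≤k)
  where
  h≤m : h ≤ m
  h≤m = ≤-trans h≤k k≤m

toFarey≥-wellDefined : ∀ m → WellDefined (InFB≥½ m) (InFarey m) toFarey≥
toFarey≥-wellDefined m (h , k) (((c , h≤k , _ , 0<k) , h≤m , _) , k≤2h) =
  Coprime.sym (coprime-∸ h≤k c) , m≤2*n⇒m∸n≤n k≤2h , h≤m , m≤2*n⇒0<n 0<k k≤2h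

fromFarey≥-wellDefined : ∀ m → WellDefined (InFarey m) (InFB≥½ m) fromFarey≥
fromFarey≥-wellDefined m (h , k) (c , h≤k , k≤m , 0<k) =
  ( ( Coprime.sym (coprime-+ c) , m≤m+n k h , +-≤-2* k≤m (≤-trans h≤k k≤m)
    , ≤-trans 0<k (m≤m+n k h))
  , k≤m , ≤-trans (≤-reflexive (m+n∸m≡n k h)) (≤-trans h≤k k≤m))
  , ≤-trans (+-monoʳ-≤ k h≤k) (≤-reflexive (sym (2*n≡n+n k)))

record InverseOn (P Q : Frac → Set) (f g : Frac → Frac) : Set where
  field
    inverseˡ : ∀ x → P x → g (f x) ≡ x
    inverseʳ : ∀ y → Q y → f (g y) ≡ y

inverseOn-sym : ∀ {P Q f g} → InverseOn P Q f g → InverseOn Q P g f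
inverseOn-sym r = record { inverseˡ = InverseOn.inverseʳ r ; inverseʳ = InverseOn.inverseˡ r }

inverseOn⇒bijectiveOn : ∀ {P Q f g} → WellDefined Q P g → InverseOn P Q f g → BijectiveOn P Q f
inverseOn⇒bijectiveOn {g = g} g-wd inv =
  (λ x y px py fx≡fy → trans (sym (inverseˡ x px)) (trans (cong g fx≡fy) (inverseˡ y py))) ,
  (λ y qy → g y , g-wd y qy , inverseʳ y qy)
  where open InverseOn inv

toFarey≤-inverseOn : ∀ m → InverseOn (InFB≤½ m) (InFarey m) toFarey≤ fromFarey≤
toFarey≤-inverseOn m = record
  { inverseˡ = λ { (h , k) p → cong (h ,_) (m∸n+n≡m (InFB⇒num≤den (h , k) (proj₁ p))) }
  ; inverseʳ = λ { (h , k) _ → cong (h ,_) (m+n∸n≡m k h) }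
  }

toFarey≥-inverseOn : ∀ m → InverseOn (InFB≥½ m) (InFarey m) toFarey≥ fromFarey≥
toFarey≥-inverseOn m = record
  { inverseˡ = λ { (h , k) p → cong (h ,_) (m+[n∸m]≡n (InFB⇒num≤den (h , k) (proj₁ p))) }
  ; inverseʳ = λ { (h , k) _ → cong (_, k) (m+n∸m≡n k h) }
  }

theorem5 : (m : ℕ) → 1 < m →
    GoodIncreasing (InFB≤½ m) (InFarey m) toFarey≤ ×
    GoodIncreasing (InFarey m) (InFB≤½ m) fromFarey≤ ×
    GoodDecreasing (InFB≥½ m) (InFarey m) toFarey≥ ×
    GoodDecreasing (InFarey m) (InFB≥½ m) fromFarey≥
theorem5 m _ =
    ( toFarey≤-wellDefined m
    , (λ x y _ py → toFarey≤-mono x y (InFB⇒num≤den y (proj₁ py)))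
    , inverseOn⇒bijectiveOn (fromFarey≤-wellDefined m) (toFarey≤-inverseOn m))
  , ( fromFarey≤-wellDefined m
    , (λ x y _ _ → fromFarey≤-mono x y)
    , inverseOn⇒bijectiveOn (toFarey≤-wellDefined m) (inverseOn-sym (toFarey≤-inverseOn m)))
  , ( toFarey≥-wellDefined m
    , (λ x y _ py → toFarey≥-antitone x y (InFB⇒num≤den y (proj₁ py)))
    , inverseOn⇒bijectiveOn (fromFarey≥-wellDefined m) (toFarey≥-inverseOn m))
  , ( fromFarey≥-wellDefined m
    , (λ x y _ _ → fromFarey≥-antitone x y)
    , inverseOn⇒bijectiveOn (toFarey≥-wellDefined m) (inverseOn-sym (toFarey≥-inverseOn m)))
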